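{- Let $R$ be the ternary relation on $\mathbb{Q}$ defined by $R(x,y,z)\iff x<y\wedge x<z\wedge y\neq z$, where $<$ is the usual order. Then the structure $(\mathbb{Q},R)$ is weakly homogeneous but not cofinally homogeneous.
   Context: Let $M$ be a countable structure. $M$ is weakly homogeneous if for every finitely generated substructure $A\subseteq M$ there exists a finitely generated substructure $B$ with $A\subseteq B\subseteq M$ such that for every embedding $f\colon B\to M$, the restriction $f\restriction A$ extends to an automorphism of $M$. $M$ is cofinally homogeneous if for every finitely generated substructure $A\subseteq M$ there exists a finitely generated substructure $B$ with $A\subseteq B\subseteq M$ such that every embedding $f\colon B\to M$ extends to an automorphism of $M$. -}

module Defs where

open import Level using (Level; _⊔_; suc)
open import Data.Product using (Σ; ∃; _×_; _,_)
open import Data.List using (List)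
open import Data.List.Membership.Propositional using (_∈_)
open import Data.List.Relation.Binary.Subset.Propositional using (_⊆_)
open import Function.Bundles using (_↔_; Inverse; _⇔_)
open import Relation.Binary.PropositionalEquality using (_≡_; _≢_)
open import Relation.Nullary using (¬_)
open import Data.Rational using (ℚ; _<_)

-- Since the language is purely relational, finitely generated substructures
-- are exactly finite subsets, represented here by lists of elements.

module _ {a ℓ : Level} {M : Set a} (R : M → M → M → Set ℓ) where

  IsEmbedding : List M → (M → M) → Set (a ⊔ ℓ)
  IsEmbedding B f =
    (∀ {x y} → x ∈ B → y ∈ B → f x ≡ f y → x ≡ y) ×
    (∀ {x y z} → x ∈ B → y ∈ B → z ∈ B → R x y z ⇔ R (f x) (f y) (f z))

  IsAutomorphism : M ↔ M → Set (a ⊔ ℓ)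
  IsAutomorphism σ = ∀ x y z → R x y z ⇔ R (to x) (to y) (to z)
    where open Inverse σ

  ExtendsToAut : List M → (M → M) → Set (a ⊔ ℓ)
  ExtendsToAut A f =
    Σ (M ↔ M) λ σ → IsAutomorphism σ × (∀ {x} → x ∈ A → Inverse.to σ x ≡ f x)

  WeaklyHomogeneous : Set (a ⊔ ℓ)
  WeaklyHomogeneous =
    ∀ (A : List M) → Σ (List M) λ B → A ⊆ B ×
      (∀ (f : M → M) → IsEmbedding B f → ExtendsToAut A f)

  CofinallyHomogeneous : Set (a ⊔ ℓ)
  CofinallyHomogeneous =
    ∀ (A : List M) → Σ (List M) λ B → A ⊆ B ×
      (∀ (f : M → M) → IsEmbedding B f → ExtendsToAut B f)

Rℚ : ℚ → ℚ → ℚ → Set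
Rℚ x y z = (x < y) × (x < z) × (y ≢ z)

-- Weak homogeneity: put one point t above a finite A.  Any embedding f of A ∪ {t} is strictly
-- increasing on A, because x < y in A is witnessed by R(x, y, t); and every strictly increasing
-- finite partial map of ℚ extends to an order automorphism, which is an automorphism of R since
-- R is defined from < and ≠.  Failure of cofinal homogeneity: let s < m be the two largest
-- elements of a finite B.  The least element x of an R-triple is below two distinct points, so
-- x < s; hence swapping s and m is an embedding of B.  But automorphisms of R preserve <, since
-- x < y is witnessed by R(x, y, y + 1).
module Submission where

open import Defs
open import Level using (Level)
open import Data.Product using (Σ; _×_; _,_; proj₁; proj₂)
open import Data.Sum using (_⊎_; inj₁; inj₂)
open import Data.List using (List; []; _∷_; filter)
open import Data.List.Relation.Unary.Any using (here; there)
open import Data.List.Relation.Unary.All using (All; lookup)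
open import Data.List.Relation.Unary.AllPairs using (AllPairs; []; _∷_)
open import Data.List.Relation.Unary.Linked.Properties using (Linked⇒AllPairs)
open import Data.List.Membership.Propositional using (_∈_)
open import Data.List.Membership.Propositional.Properties using (∈-filter⁺; ∈-filter⁻)
open import Data.List.Relation.Binary.Permutation.Propositional using (↭-sym)
open import Data.List.Relation.Binary.Permutation.Propositional.Properties using (∈-resp-↭)
open import Algebra.Definitions using (Involutive)
open import Function.Base using (_∘_)
open import Function.Bundles using (_↔_; Inverse; mk↔ₛ′; mk⇔; Equivalence)
open import Relation.Binary.Bundles using (DecTotalOrder)
open import Relation.Binary.Definitions using (DecidableEquality; tri<; tri≈; tri>)
open import Relation.Binary.PropositionalEquality
open import Relation.Nullary using (¬_; yes; no; does; contradiction)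
open import Relation.Nullary.Decidable using (dec-true; dec-false)
open import Data.Bool using (if_then_else_)
open import Data.Rational
  using (ℚ; _<_; _≤_; _+_; _*_; _-_; -_; _÷_; 1/_; 0ℚ; 1ℚ; Positive; NonZero; positive)
import Data.Rational.Properties as ℚ
open import Data.Rational.Solver using (module +-*-Solver)
open +-*-Solver using (solve; _:=_; _:+_; _:-_; _:*_; :-_; con)
open import Data.List.Extrema (DecTotalOrder.totalOrder ℚ.≤-decTotalOrder) using (max; xs≤max; argmax-sel)
import Data.List.Sort

module Transposition {a} {A : Set a} (_≟_ : DecidableEquality A) where

  transpose : A → A → A → A
  transpose i j x = if does (x ≟ i) then j else if does (x ≟ j) then i else x

  transpose-matchˡ : ∀ i j → transpose i j i ≡ j
  transpose-matchˡ i j rewrite dec-true (i ≟ i) refl = refl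

  transpose-matchʳ : ∀ i j → transpose i j j ≡ i
  transpose-matchʳ i j with j ≟ i
  ... | yes refl = refl
  ... | no j≢i rewrite dec-true (j ≟ j) refl = refl

  transpose-other : ∀ {i j x} → x ≢ i → x ≢ j → transpose i j x ≡ x
  transpose-other {i} {j} {x} x≢i x≢j rewrite dec-false (x ≟ i) x≢i | dec-false (x ≟ j) x≢j = refl

  transpose-cases : ∀ i j x → x ≡ i ⊎ x ≡ j ⊎ (x ≢ i × x ≢ j)
  transpose-cases i j x with x ≟ i | x ≟ j
  ... | yes x≡i | _ = inj₁ x≡i
  ... | no _ | yes x≡j = inj₂ (inj₁ x≡j)
  ... | no x≢i | no x≢j = inj₂ (inj₂ (x≢i , x≢j))

  transpose-involutive : ∀ i j → Involutive _≡_ (transpose i j)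
  transpose-involutive i j x with transpose-cases i j x
  ... | inj₁ refl = trans (cong (transpose i j) (transpose-matchˡ i j)) (transpose-matchʳ i j)
  ... | inj₂ (inj₁ refl) = trans (cong (transpose i j) (transpose-matchʳ i j)) (transpose-matchˡ i j)
  ... | inj₂ (inj₂ (x≢i , x≢j)) =
    trans (cong (transpose i j) (transpose-other x≢i x≢j)) (transpose-other x≢i x≢j)

  transpose-injective : ∀ i j {x y} → transpose i j x ≡ transpose i j y → x ≡ y
  transpose-injective i j {x} {y} eq = trans (sym (transpose-involutive i j x))
    (trans (cong (transpose i j) eq) (transpose-involutive i j y))

  transpose-∈ : ∀ {i j x} {B : List A} → i ∈ B → j ∈ B → x ∈ B → transpose i j x ∈ B
  transpose-∈ {i} {j} {x} i∈B j∈B x∈B with transpose-cases i j x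
  ... | inj₁ refl = subst (_∈ _) (sym (transpose-matchˡ i j)) j∈B
  ... | inj₂ (inj₁ refl) = subst (_∈ _) (sym (transpose-matchʳ i j)) i∈B
  ... | inj₂ (inj₂ (x≢i , x≢j)) = subst (_∈ _) (sym (transpose-other x≢i x≢j)) x∈B

module _ {a ℓ : Level} {M : Set a} (R : M → M → M → Set ℓ) where

  involution⇒embedding : ∀ {B f} → Involutive _≡_ f → (∀ {x} → x ∈ B → f x ∈ B) →
    (∀ {x y z} → x ∈ B → y ∈ B → z ∈ B → R x y z → R (f x) (f y) (f z)) →
    IsEmbedding R B f
  involution⇒embedding {B} {f} invol f[B]⊆B preserves =
    injective , λ x∈ y∈ z∈ → mk⇔ (preserves x∈ y∈ z∈) (reflects x∈ y∈ z∈)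
    where
    reflects : ∀ {x y z} → x ∈ B → y ∈ B → z ∈ B → R (f x) (f y) (f z) → R x y z
    reflects {x} {y} {z} x∈ y∈ z∈ =
      subst₂ (λ u v → R u v z) (invol x) (invol y) ∘ subst (R _ _) (invol z) ∘
      preserves (f[B]⊆B x∈) (f[B]⊆B y∈) (f[B]⊆B z∈)
    injective : ∀ {x y} → x ∈ B → y ∈ B → f x ≡ f y → x ≡ y
    injective {x} {y} _ _ fx≡fy = trans (sym (invol x)) (trans (cong f fx≡fy) (invol y))

p<q⇒0<q-p : ∀ {p q} → p < q → 0ℚ < q - p
p<q⇒0<q-p {p} {q} p<q = subst (_< q - p) (ℚ.+-inverseʳ p) (ℚ.+-monoˡ-< (- p) p<q)

p<q⇒p-q<0 : ∀ {p q} → p < q → p - q < 0ℚ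
p<q⇒p-q<0 {p} {q} p<q = subst (p - q <_) (ℚ.+-inverseʳ q) (ℚ.+-monoˡ-< (- q) p<q)

≤⇒≮ : ∀ {p q} → p ≤ q → ¬ q < p
≤⇒≮ p≤q q<p = ℚ.<-irrefl refl (ℚ.≤-<-trans p≤q q<p)

record OrderAutomorphism : Set where
  field
    to from   : ℚ → ℚ
    to-from   : ∀ x → to (from x) ≡ x
    from-to   : ∀ x → from (to x) ≡ x
    to-mono-< : ∀ {x y} → x < y → to x < to y

  toInverse : ℚ ↔ ℚ
  toInverse = mk↔ₛ′ to from to-from from-to

  to-injective : ∀ {x y} → to x ≡ to y → x ≡ y
  to-injective {x} {y} tx≡ty = trans (sym (from-to x)) (trans (cong from tx≡ty) (from-to y))

  to-cancel-< : ∀ {x y} → to x < to y → x < y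
  to-cancel-< {x} {y} tx<ty with ℚ.<-cmp x y
  ... | tri< x<y _ _ = x<y
  ... | tri≈ _ refl _ = contradiction tx<ty (ℚ.<-irrefl refl)
  ... | tri> _ _ y<x = contradiction (to-mono-< y<x) (ℚ.<-asym tx<ty)

  to-mono-≤ : ∀ {x y} → x ≤ y → to x ≤ to y
  to-mono-≤ {x} {y} x≤y with ℚ.<-cmp x y
  ... | tri< x<y _ _ = ℚ.<⇒≤ (to-mono-< x<y)
  ... | tri≈ _ refl _ = ℚ.≤-refl
  ... | tri> _ _ y<x = contradiction y<x (≤⇒≮ x≤y)

open OrderAutomorphism

identity : OrderAutomorphism
identity = record
  { to = λ x → x ; from = λ x → x ; to-from = λ _ → refl ; from-to = λ _ → refl ; to-mono-< = λ x<y → x<y }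

_∘ᵒ_ : OrderAutomorphism → OrderAutomorphism → OrderAutomorphism
τ ∘ᵒ σ = record
  { to = to τ ∘ to σ
  ; from = from σ ∘ from τ
  ; to-from = λ x → trans (cong (to τ) (to-from σ (from τ x))) (to-from τ x)
  ; from-to = λ x → trans (cong (from σ) (from-to τ (to σ x))) (from-to σ x)
  ; to-mono-< = to-mono-< τ ∘ to-mono-< σ
  }

translation : ℚ → OrderAutomorphism
translation c = record
  { to = _+ c
  ; from = _- c
  ; to-from = λ x → solve 2 (λ x c → (x :- c) :+ c := x) refl x c
  ; from-to = λ x → solve 2 (λ x c → (x :+ c) :- c := x) refl x c
  ; to-mono-< = ℚ.+-monoˡ-< c
  }

module _ (p : ℚ) where

  stretchBelow : (k : ℚ) → .{{Positive k}} → ℚ → ℚ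
  stretchBelow k x with x ℚ.<? p
  ... | yes _ = p + (x - p) * k
  ... | no _  = x

  module _ (k : ℚ) .{{_ : Positive k}} where

    stretchBelow-< : ∀ {x} → x < p → stretchBelow k x ≡ p + (x - p) * k
    stretchBelow-< {x} x<p with x ℚ.<? p
    ... | yes _ = refl
    ... | no x≮p = contradiction x<p x≮p

    stretchBelow-≮ : ∀ {x} → ¬ x < p → stretchBelow k x ≡ x
    stretchBelow-≮ {x} x≮p with x ℚ.<? p
    ... | yes x<p = contradiction x<p x≮p
    ... | no _ = refl

    stretched<p : ∀ {x} → x < p → p + (x - p) * k < p
    stretched<p {x} x<p = subst (p + (x - p) * k <_) (ℚ.+-identityʳ p)
      (ℚ.+-monoʳ-< p (subst ((x - p) * k <_) (ℚ.*-zeroˡ k) (ℚ.*-monoˡ-<-pos k (p<q⇒p-q<0 x<p))))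

    stretchBelow-mono-< : ∀ {x y} → x < y → stretchBelow k x < stretchBelow k y
    stretchBelow-mono-< {x} {y} x<y with x ℚ.<? p | y ℚ.<? p
    ... | yes _   | yes _   = ℚ.+-monoʳ-< p (ℚ.*-monoˡ-<-pos k (ℚ.+-monoˡ-< (- p) x<y))
    ... | yes x<p | no y≮p  = ℚ.<-≤-trans (stretched<p x<p) (ℚ.≮⇒≥ y≮p)
    ... | no x≮p  | yes y<p = contradiction (ℚ.<-trans x<y y<p) x≮p
    ... | no _    | no _    = x<y

  stretchBelow-inverse : ∀ k l .{{_ : Positive k}} .{{_ : Positive l}} → l * k ≡ 1ℚ →
                         ∀ x → stretchBelow k (stretchBelow l x) ≡ x
  stretchBelow-inverse k l lk≡1 x with x ℚ.<? p
  ... | no x≮p = stretchBelow-≮ k x≮p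
  ... | yes x<p = begin
    stretchBelow k (p + (x - p) * l)   ≡⟨ stretchBelow-< k (stretched<p l x<p) ⟩
    p + ((p + (x - p) * l) - p) * k   ≡⟨ solve 4 (λ p x k l → p :+ ((p :+ (x :- p) :* l) :- p) :* k
                                                        := p :+ (x :- p) :* (l :* k)) refl p x k l ⟩
    p + (x - p) * (l * k)             ≡⟨ cong (λ c → p + (x - p) * c) lk≡1 ⟩
    p + (x - p) * 1ℚ                  ≡⟨ solve 2 (λ p x → p :+ (x :- p) :* con 1ℚ := x) refl p x ⟩
    x                                 ∎
    where open ≡-Reasoning

  stretchBelowAut : (k : ℚ) → .{{Positive k}} → OrderAutomorphism
  stretchBelowAut k = record
    { to = stretchBelow k
    ; from = stretchBelow (1/ k)
    ; to-from = stretchBelow-inverse k (1/ k) (ℚ.*-inverseˡ k)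
    ; from-to = stretchBelow-inverse (1/ k) k (ℚ.*-inverseʳ k)
    ; to-mono-< = stretchBelow-mono-< k
    }
    where instance
      k≢0 : NonZero k
      k≢0 = ℚ.pos⇒nonZero k
      1/k>0 : Positive (1/ k)
      1/k>0 = ℚ.1/pos⇒pos k

moveBelow : ∀ {p u v} → u < p → v < p →
            Σ OrderAutomorphism λ τ → to τ u ≡ v × (∀ {x} → p ≤ x → to τ x ≡ x)
moveBelow {p} {u} {v} u<p v<p = stretchBelowAut p k , u↦v , λ p≤x → stretchBelow-≮ p k (≤⇒≮ p≤x)
  where
  instance
    p-u>0 : Positive (p - u)
    p-u>0 = positive (p<q⇒0<q-p u<p)
    p-v>0 : Positive (p - v)
    p-v>0 = positive (p<q⇒0<q-p v<p)
    p-u≢0 : NonZero (p - u)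
    p-u≢0 = ℚ.pos⇒nonZero (p - u)
    1/[p-u]>0 : Positive (1/ (p - u))
    1/[p-u]>0 = ℚ.1/pos⇒pos (p - u)
  k : ℚ
  k = (p - v) ÷ (p - u)
  instance
    k>0 : Positive k
    k>0 = ℚ.pos*pos⇒pos (p - v) (1/ (p - u))
  open ≡-Reasoning
  u↦v : stretchBelow p k u ≡ v
  u↦v = begin
    stretchBelow p k u                          ≡⟨ stretchBelow-< p k u<p ⟩
    p + (u - p) * ((p - v) * 1/ (p - u))        ≡⟨ solve 4 (λ p u v i → p :+ (u :- p) :* ((p :- v) :* i)
                                                      := p :+ (:- (p :- v)) :* ((p :- u) :* i)) refl p u v _ ⟩
    p + (- (p - v)) * ((p - u) * 1/ (p - u))    ≡⟨ cong (λ c → p + (- (p - v)) * c) (ℚ.*-inverseʳ (p - u)) ⟩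
    p + (- (p - v)) * 1ℚ                        ≡⟨ solve 2 (λ p v → p :+ (:- (p :- v)) :* con 1ℚ := v) refl p v ⟩
    v                                           ∎

orderAutomorphism⇒automorphism : (σ : OrderAutomorphism) → IsAutomorphism Rℚ (toInverse σ)
orderAutomorphism⇒automorphism σ x y z = mk⇔
  (λ (x<y , x<z , y≢z) → to-mono-< σ x<y , to-mono-< σ x<z , y≢z ∘ to-injective σ)
  (λ (x<y , x<z , y≢z) → to-cancel-< σ x<y , to-cancel-< σ x<z , y≢z ∘ cong (to σ))

p<p+1 : ∀ p → p < p + 1ℚ
p<p+1 p = subst (_< p + 1ℚ) (ℚ.+-identityʳ p) (ℚ.+-monoʳ-< p (ℚ.positive⁻¹ 1ℚ))

automorphism⇒mono-< : (σ : ℚ ↔ ℚ) → IsAutomorphism Rℚ σ → ∀ {x y} → x < y → Inverse.to σ x < Inverse.to σ y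
automorphism⇒mono-< σ σ-aut {x} {y} x<y =
  proj₁ (Equivalence.to (σ-aut x y (y + 1ℚ)) (x<y , ℚ.<-trans x<y (p<p+1 y) , ℚ.<⇒≢ (p<p+1 y)))

StrictlyIncreasingOn : List ℚ → (ℚ → ℚ) → Set
StrictlyIncreasingOn L f = ∀ {x y} → x ∈ L → y ∈ L → x < y → f x < f y

_AgreesWith_On_ : OrderAutomorphism → (ℚ → ℚ) → List ℚ → Set
σ AgreesWith f On L = ∀ {x} → x ∈ L → to σ x ≡ f x

extend-below : ∀ {a b L f} → a < b → All (b ≤_) L → f a < f b →
               (σ : OrderAutomorphism) → σ AgreesWith f On (b ∷ L) →
               Σ OrderAutomorphism λ τ → τ AgreesWith f On (a ∷ b ∷ L)
extend-below {a} {b} {L} {f} a<b b≤L fa<fb σ σ≈f = τ ∘ᵒ σ , λ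
  { (here refl) → τ[σa]≡fa
  ; (there x∈) → trans (τ-fixes (fb≤σx x∈)) (σ≈f x∈) }
  where
  σb≡fb : to σ b ≡ f b
  σb≡fb = σ≈f (here refl)
  σa<fb : to σ a < f b
  σa<fb = subst (to σ a <_) σb≡fb (to-mono-< σ a<b)
  fb≤σx : ∀ {x} → x ∈ b ∷ L → f b ≤ to σ x
  fb≤σx (here refl) = ℚ.≤-reflexive (sym σb≡fb)
  fb≤σx {x} (there x∈) = subst (_≤ to σ x) σb≡fb (to-mono-≤ σ (lookup b≤L x∈))
  moved : Σ OrderAutomorphism λ τ → to τ (to σ a) ≡ f a × (∀ {x} → f b ≤ x → to τ x ≡ x)
  moved = moveBelow σa<fb fa<fb
  τ : OrderAutomorphism
  τ = proj₁ moved
  τ[σa]≡fa : to τ (to σ a) ≡ f a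
  τ[σa]≡fa = proj₁ (proj₂ moved)
  τ-fixes : ∀ {x} → f b ≤ x → to τ x ≡ x
  τ-fixes = proj₂ (proj₂ moved)

extend-sorted : ∀ {L} → AllPairs _≤_ L → ∀ f → StrictlyIncreasingOn L f →
                Σ OrderAutomorphism λ σ → σ AgreesWith f On L
extend-sorted {[]} _ f _ = identity , λ ()
extend-sorted {a ∷ []} _ f _ =
  translation (f a - a) , λ { (here refl) → solve 2 (λ a b → a :+ (b :- a) := b) refl a (f a) }
extend-sorted {a ∷ b ∷ L} (a≤ ∷ sorted@(b≤L ∷ _)) f f-inc
  with extend-sorted sorted f (λ x∈ y∈ → f-inc (there x∈) (there y∈)) | ℚ.<-cmp a b
... | σ , σ≈f | tri< a<b _ _ = extend-below a<b b≤L (f-inc (here refl) (there (here refl)) a<b) σ σ≈f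
... | σ , σ≈f | tri≈ _ refl _ = σ , λ { (here refl) → σ≈f (here refl) ; (there x∈) → σ≈f x∈ }
... | _ | tri> _ _ b<a = contradiction b<a (≤⇒≮ (lookup a≤ (here refl)))

open Data.List.Sort ℚ.≤-decTotalOrder using (sort; sort-↭; sort-↗)

extend : ∀ L f → StrictlyIncreasingOn L f → Σ OrderAutomorphism λ σ → σ AgreesWith f On L
extend L f f-inc with extend-sorted (Linked⇒AllPairs ℚ.≤-trans (sort-↗ L)) f
                        (λ x∈ y∈ → f-inc (∈-resp-↭ (sort-↭ L) x∈) (∈-resp-↭ (sort-↭ L) y∈))
... | σ , σ≈f = σ , λ x∈ → σ≈f (∈-resp-↭ (↭-sym (sort-↭ L)) x∈)

weaklyHomogeneous : WeaklyHomogeneous Rℚ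
weaklyHomogeneous A = t ∷ A , there , extends
  where
  t : ℚ
  t = max 0ℚ A + 1ℚ
  A<t : ∀ {x} → x ∈ A → x < t
  A<t x∈ = ℚ.≤-<-trans (lookup (xs≤max 0ℚ A) x∈) (p<p+1 _)
  extends : ∀ f → IsEmbedding Rℚ (t ∷ A) f → ExtendsToAut Rℚ A f
  extends f (_ , f-pres) with extend A f (λ x∈ y∈ x<y → proj₁
    (Equivalence.to (f-pres (there x∈) (there y∈) (here refl)) (x<y , A<t x∈ , ℚ.<⇒≢ (A<t y∈))))
  ... | σ , σ≈f = toInverse σ , orderAutomorphism⇒automorphism σ , σ≈f

record TopTwo (B : List ℚ) : Set where
  field
    second top : ℚ
    second∈B   : second ∈ B
    top∈B      : top ∈ B
    second<top : second < top
    ≤second    : ∀ {w} → w ∈ B → w ≢ top → w ≤ second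

topTwo : ∀ {B x y} → x ∈ B → y ∈ B → x < y → TopTwo B
topTwo {B} {x} {y} x∈B y∈B x<y = record
  { second = s ; top = m ; second∈B = s∈B ; top∈B = m∈B ; second<top = s<m ; ≤second = ≤s }
  where
  m : ℚ
  m = max x B
  ≤m : ∀ {w} → w ∈ B → w ≤ m
  ≤m = lookup (xs≤max x B)
  m∈B : m ∈ B
  m∈B with argmax-sel (λ w → w) x B
  ... | inj₁ m≡x = subst (_∈ B) (sym m≡x) x∈B
  ... | inj₂ m∈ = m∈
  below-m : List ℚ
  below-m = filter (ℚ._<? m) B
  s : ℚ
  s = max x below-m
  s∈B : s ∈ B
  s<m : s < m
  s∈B with argmax-sel (λ w → w) x below-m
  ... | inj₁ s≡x = subst (_∈ B) (sym s≡x) x∈B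
  ... | inj₂ s∈ = proj₁ (∈-filter⁻ (ℚ._<? m) s∈)
  s<m with argmax-sel (λ w → w) x below-m
  ... | inj₁ s≡x = subst (_< m) (sym s≡x) (ℚ.<-≤-trans x<y (≤m y∈B))
  ... | inj₂ s∈ = proj₂ (∈-filter⁻ (ℚ._<? m) {xs = B} s∈)
  ≤s : ∀ {w} → w ∈ B → w ≢ m → w ≤ s
  ≤s {w} w∈B w≢m with ℚ.<-cmp w m
  ... | tri< w<m _ _ = lookup (xs≤max x below-m) (∈-filter⁺ (ℚ._<? m) w∈B w<m)
  ... | tri≈ _ w≡m _ = contradiction w≡m w≢m
  ... | tri> _ _ m<w = contradiction m<w (≤⇒≮ (≤m w∈B))

module SwapTopTwo {B : List ℚ} (T : TopTwo B) where
  open TopTwo T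
  open Transposition ℚ._≟_

  swap : ℚ → ℚ
  swap = transpose second top

  <second⇒<swap : ∀ {x w} → x < second → x < w → x < swap w
  <second⇒<swap {x} {w} x<s x<w with transpose-cases second top w
  ... | inj₁ refl = subst (x <_) (sym (transpose-matchˡ second top)) (ℚ.<-trans x<s second<top)
  ... | inj₂ (inj₁ refl) = subst (x <_) (sym (transpose-matchʳ second top)) x<s
  ... | inj₂ (inj₂ (w≢s , w≢t)) = subst (x <_) (sym (transpose-other w≢s w≢t)) x<w

  least<second : ∀ {x y z} → y ∈ B → z ∈ B → Rℚ x y z → x < second
  least<second {y = y} y∈B z∈B (x<y , x<z , y≢z) with y ℚ.≟ top
  ... | no y≢t = ℚ.<-≤-trans x<y (≤second y∈B y≢t)
  ... | yes refl = ℚ.<-≤-trans x<z (≤second z∈B (y≢z ∘ sym))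

  swap-preserves : ∀ {x y z} → x ∈ B → y ∈ B → z ∈ B → Rℚ x y z → Rℚ (swap x) (swap y) (swap z)
  swap-preserves {x} {y} {z} _ y∈B z∈B R@(x<y , x<z , y≢z) =
    subst (_< swap y) (sym swap-x≡x) (<second⇒<swap x<s x<y) ,
    subst (_< swap z) (sym swap-x≡x) (<second⇒<swap x<s x<z) ,
    y≢z ∘ transpose-injective second top
    where
    x<s : x < second
    x<s = least<second y∈B z∈B R
    swap-x≡x : swap x ≡ x
    swap-x≡x = transpose-other (ℚ.<⇒≢ x<s) (ℚ.<⇒≢ (ℚ.<-trans x<s second<top))

  swap-embedding : IsEmbedding Rℚ B swap
  swap-embedding = involution⇒embedding Rℚ (transpose-involutive second top)
    (transpose-∈ second∈B top∈B) swap-preserves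

  swap-not-extendable : ¬ ExtendsToAut Rℚ B swap
  swap-not-extendable (σ , σ-aut , σ≈swap) = ℚ.<-asym second<top (subst₂ _<_
    (trans (σ≈swap second∈B) (transpose-matchˡ second top))
    (trans (σ≈swap top∈B) (transpose-matchʳ second top))
    (automorphism⇒mono-< σ σ-aut second<top))

notCofinallyHomogeneous : ¬ CofinallyHomogeneous Rℚ
notCofinallyHomogeneous cofinal with cofinal (0ℚ ∷ 1ℚ ∷ [])
... | B , 01⊆B , extends = swap-not-extendable (extends swap swap-embedding)
  where
  open SwapTopTwo (topTwo (01⊆B (here refl)) (01⊆B (there (here refl))) (ℚ.positive⁻¹ 1ℚ))

mainTheorem12 : WeaklyHomogeneous Rℚ × ¬ CofinallyHomogeneous Rℚ
mainTheorem12 = weaklyHomogeneous , notCofinallyHomogeneous
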